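{- Let $k\ge 2$ and $\ell\ge 1$, and let $G_1,\dots,G_\ell$ be finite graphs on the same vertex set $V$, where $G_i$ has $m_i$ edges. Then there is a partition of $V$ into $k$ classes $V_1,\dots,V_k$ such that for all $i=1,\dots,\ell$ the number of edges of $G_i$ whose two endvertices lie in different classes $V_s\neq V_t$ is at least $$\frac{(k-1)m_i}{k}-\sqrt{2\ell m_i}.$$
   Context: Graphs are finite and simple. A partition of $V$ into $k$ classes means pairwise disjoint sets $V_1,\dots,V_k$ with union $V$ (classes are allowed to be empty). -}

module Defs where

open import Data.Nat using (ℕ; zero; suc; _+_; _<ᵇ_)
open import Data.Bool using (Bool; true; false; _∧_; not)
open import Data.Fin using (Fin; toℕ; _≟_)
open import Data.List using (List; []; _∷_; allFin; cartesianProduct)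
open import Data.Product using (_×_; _,_; proj₁; proj₂)
open import Relation.Nullary using (does)
open import Relation.Binary.PropositionalEquality using (_≡_)

record Graph (n : ℕ) : Set where
  field
    adj    : Fin n → Fin n → Bool
    sym    : ∀ i j → adj i j ≡ adj j i
    irrefl : ∀ i → adj i i ≡ false
open Graph public

count : ∀ {A : Set} → (A → Bool) → List A → ℕ
count p [] = 0
count p (x ∷ xs) with p x
... | true  = suc (count p xs)
... | false = count p xs

orderedPairs : (n : ℕ) → List (Fin n × Fin n)
orderedPairs n = go (cartesianProduct (allFin n) (allFin n))
  where
  go : List (Fin n × Fin n) → List (Fin n × Fin n)
  go [] = []
  go ((i , j) ∷ ps) with toℕ i <ᵇ toℕ j
  ... | true  = (i , j) ∷ go ps
  ... | false = go ps

edgeCount : ∀ {n} → Graph n → ℕ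
edgeCount {n} G = count (λ p → adj G (proj₁ p) (proj₂ p)) (orderedPairs n)

-- A partition of V = Fin n into k (possibly empty) classes V_1..V_k is
-- given by the class-assignment function Fin n → Fin k.
Partition : ℕ → ℕ → Set
Partition n k = Fin n → Fin k

cutCount : ∀ {n k} → Graph n → Partition n k → ℕ
cutCount {n} G f =
  count (λ p → adj G (proj₁ p) (proj₂ p) ∧ not (does (f (proj₁ p) ≟ f (proj₂ p))))
        (orderedPairs n)

{-# OPTIONS --safe #-}
-- Put every vertex into one of the k classes uniformly at random and, for an edge uv, let
-- Z_uv = k·[f u = f v] − 1, so that Y = Σ_{uv ∈ E} Z_uv equals (k − 1)m − k·cut.
-- Resampling the class of a single vertex shows that the Z_uv of distinct edges are
-- orthogonal and that E[Z_uv²] = k − 1, hence E[Y²] = (k − 1)m.  By Markov's inequality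
-- Y² > 2ℓk²m has probability at most 1/(2ℓ), so by the union bound some partition has
-- Y_i² ≤ 2ℓk²m_i for every i, which is the claimed bound.  Expectations are sums over
-- all kⁿ partitions, taken in ℤ.
module Submission where

open import Defs hiding (sym)
open import Data.Bool using (Bool; true; false; _∧_; not)
open import Data.Fin as Fin using (Fin; zero; suc; toℕ; _≟_)
import Data.Fin.Properties as Fin
open import Data.Integer as ℤ using (ℤ; +_; -[1+_]; 0ℤ; 1ℤ; _+_; _*_; _-_; -_; _≤_; _<_; +≤+; +<+)
import Data.Integer.Properties as ℤ
open import Data.Integer.Tactic.RingSolver using (solve-∀)
open import Algebra.Properties.Semiring.Sum ℤ.+-*-semiring
  using (sum; sum-syntax; ∑-distrib-+; ∑-comm; *-distribˡ-sum; sum-cong-≗; sum-remove)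
open import Data.List using (List; []; _∷_; filter; cartesianProduct; allFin)
open import Data.List.Relation.Unary.All as All using (All; []; _∷_)
import Data.List.Relation.Unary.All.Properties as All
open import Data.List.Relation.Unary.AllPairs using (AllPairs; []; _∷_)
open import Data.List.Relation.Unary.Unique.Propositional using (Unique)
import Data.List.Relation.Unary.Unique.Propositional.Properties as Unique
open import Data.Nat as ℕ using (ℕ; zero; suc; z≤n; s≤s; NonZero; _^_)
import Data.Nat.Properties as ℕ
open import Data.Nat.Tactic.RingSolver using () renaming (solve-∀ to ℕ-solve-∀)
open import Data.Product using (Σ; Σ-syntax; _,_; _×_)
open import Data.Sum using (_⊎_; inj₁; inj₂)
import Data.Vec.Functional as V
open import Function using (_∘_)
open import Relation.Binary.PropositionalEquality
open import Relation.Nullary using (does; yes; no; contradiction)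
open import Relation.Unary using (Decidable)

𝟙 : Bool → ℤ
𝟙 true  = 1ℤ
𝟙 false = 0ℤ

𝟙-nonneg : ∀ b → 0ℤ ≤ 𝟙 b
𝟙-nonneg true  = +≤+ z≤n
𝟙-nonneg false = +≤+ z≤n

𝟙<1⇒false : ∀ {b} → 𝟙 b < 1ℤ → b ≡ false
𝟙<1⇒false {false} _               = refl
𝟙<1⇒false {true}  (+<+ (s≤s ()))

square-nonneg : ∀ i → 0ℤ ≤ i * i
square-nonneg (+ n)    = subst (0ℤ ≤_) (ℤ.pos-* n n) (+≤+ z≤n)
square-nonneg -[1+ n ] = +≤+ z≤n

∑-const : ∀ m a → ∑[ i < m ] a ≡ + m * a
∑-const zero    a = sym (ℤ.*-zeroˡ a)
∑-const (suc m) a = trans (cong (λ s → a + s) (∑-const m a)) (sym (ℤ.suc-* (+ m) a))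

∑-mono-≤ : ∀ {m} {g h : Fin m → ℤ} → (∀ i → g i ≤ h i) → sum g ≤ sum h
∑-mono-≤ {zero}  g≤h = ℤ.≤-refl
∑-mono-≤ {suc m} g≤h = ℤ.+-mono-≤ (g≤h zero) (∑-mono-≤ (g≤h ∘ suc))

∑-nonneg : ∀ {m} {h : Fin m → ℤ} → (∀ i → 0ℤ ≤ h i) → 0ℤ ≤ sum h
∑-nonneg {m} {h} h≥0 = subst (_≤ sum h) (trans (∑-const m 0ℤ) (ℤ.*-zeroʳ (+ m))) (∑-mono-≤ h≥0)

term≤∑ : ∀ {m} {h : Fin m → ℤ} → (∀ i → 0ℤ ≤ h i) → ∀ i → h i ≤ sum h
term≤∑ {suc m} {h} h≥0 i = subst (h i ≤_) (sym (sum-remove h))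
  (subst (_≤ h i + rest) (ℤ.+-identityʳ (h i)) (ℤ.+-monoʳ-≤ (h i) rest≥0))
  where
  rest : ℤ
  rest = sum (V.removeAt h i)
  rest≥0 : 0ℤ ≤ rest
  rest≥0 = ∑-nonneg (h≥0 ∘ Fin.punchIn i)

∑-<-witness : ∀ {m} (g h : Fin m → ℤ) → sum g < sum h → Σ[ i ∈ Fin m ] g i < h i
∑-<-witness {zero}  g h (+<+ ())
∑-<-witness {suc m} g h ∑g<∑h with g zero ℤ.<? h zero | sum (g ∘ suc) ℤ.<? sum (h ∘ suc)
... | yes g₀<h₀ | _         = zero , g₀<h₀
... | no  _     | yes ∑<∑   = let i , gᵢ<hᵢ = ∑-<-witness (g ∘ suc) (h ∘ suc) ∑<∑ in suc i , gᵢ<hᵢ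
... | no  g₀≮h₀ | no  ∑≮∑   = contradiction (ℤ.+-mono-≤ (ℤ.≮⇒≥ g₀≮h₀) (ℤ.≮⇒≥ ∑≮∑)) (ℤ.<⇒≱ ∑g<∑h)

∑ˡ : {A : Set} → List A → (A → ℤ) → ℤ
∑ˡ []       h = 0ℤ
∑ˡ (x ∷ xs) h = h x + ∑ˡ xs h

count≡∑ˡ𝟙 : ∀ {A : Set} (p : A → Bool) xs → + count p xs ≡ ∑ˡ xs (𝟙 ∘ p)
count≡∑ˡ𝟙 p []       = refl
count≡∑ˡ𝟙 p (x ∷ xs) with p x
... | true  = cong (λ s → 1ℤ + s) (count≡∑ˡ𝟙 p xs)
... | false = trans (count≡∑ˡ𝟙 p xs) (sym (ℤ.+-identityˡ _))

∑ˡ-cong : ∀ {A : Set} {xs} {g h : A → ℤ} → All (λ x → g x ≡ h x) xs → ∑ˡ xs g ≡ ∑ˡ xs h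
∑ˡ-cong []            = refl
∑ˡ-cong (gx≡hx ∷ eqs) = cong₂ _+_ gx≡hx (∑ˡ-cong eqs)

∑ˡ-zero : ∀ {A : Set} {xs} {h : A → ℤ} → All (λ x → h x ≡ 0ℤ) xs → ∑ˡ xs h ≡ 0ℤ
∑ˡ-zero []           = refl
∑ˡ-zero (hx≡0 ∷ eqs) = trans (cong₂ _+_ hx≡0 (∑ˡ-zero eqs)) (ℤ.+-identityˡ 0ℤ)

∑ˡ-linear : ∀ {A : Set} xs α β (g h : A → ℤ) →
  ∑ˡ xs (λ x → α * g x - β * h x) ≡ α * ∑ˡ xs g - β * ∑ˡ xs h
∑ˡ-linear []       α β g h = sym (zero-case α β)
  where
  zero-case : ∀ α β → α * 0ℤ - β * 0ℤ ≡ 0ℤ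
  zero-case = solve-∀
∑ˡ-linear (x ∷ xs) α β g h =
  trans (cong (λ s → α * g x - β * h x + s) (∑ˡ-linear xs α β g h)) (regroup α β (g x) (h x) _ _)
  where
  regroup : ∀ α β a b A B → α * a - β * b + (α * A - β * B) ≡ α * (a + A) - β * (b + B)
  regroup = solve-∀

*-distribˡ-∑ˡ : ∀ {A : Set} a xs (h : A → ℤ) → a * ∑ˡ xs h ≡ ∑ˡ xs (λ x → a * h x)
*-distribˡ-∑ˡ a []       h = ℤ.*-zeroʳ a
*-distribˡ-∑ˡ a (x ∷ xs) h =
  trans (ℤ.*-distribˡ-+ a (h x) _) (cong (λ s → a * h x + s) (*-distribˡ-∑ˡ a xs h))

∑ᴾ : ∀ {n k} → (Partition n k → ℤ) → ℤ
∑ᴾ {zero}      h = h (λ ())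
∑ᴾ {suc n} {k} h = ∑[ c < k ] ∑ᴾ (h ∘ (c V.∷_))

module _ {k : ℕ} where

  ∑ᴾ-cong : ∀ {n} {g h : Partition n k → ℤ} → (∀ f → g f ≡ h f) → ∑ᴾ g ≡ ∑ᴾ h
  ∑ᴾ-cong {zero}  g≗h = g≗h _
  ∑ᴾ-cong {suc n} g≗h = sum-cong-≗ (λ c → ∑ᴾ-cong (g≗h ∘ (c V.∷_)))

  ∑ᴾ-distrib-+ : ∀ {n} (g h : Partition n k → ℤ) → ∑ᴾ (λ f → g f + h f) ≡ ∑ᴾ g + ∑ᴾ h
  ∑ᴾ-distrib-+ {zero}  g h = refl
  ∑ᴾ-distrib-+ {suc n} g h =
    trans (sum-cong-≗ (λ c → ∑ᴾ-distrib-+ (g ∘ (c V.∷_)) (h ∘ (c V.∷_))))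
          (∑-distrib-+ (λ c → ∑ᴾ (g ∘ (c V.∷_))) (λ c → ∑ᴾ (h ∘ (c V.∷_))))

  *-distribˡ-∑ᴾ : ∀ {n} a (h : Partition n k → ℤ) → a * ∑ᴾ h ≡ ∑ᴾ (λ f → a * h f)
  *-distribˡ-∑ᴾ {zero}  a h = refl
  *-distribˡ-∑ᴾ {suc n} a h =
    trans (*-distribˡ-sum a (λ c → ∑ᴾ (h ∘ (c V.∷_))))
          (sum-cong-≗ (λ c → *-distribˡ-∑ᴾ a (h ∘ (c V.∷_))))

  ∑ᴾ-const : ∀ n a → ∑ᴾ {n} {k} (λ _ → a) ≡ + (k ^ n) * a
  ∑ᴾ-const zero    a = sym (ℤ.*-identityˡ a)
  ∑ᴾ-const (suc n) a = begin
    ∑[ _ < k ] ∑ᴾ {n} (λ _ → a)  ≡⟨ cong (λ s → ∑[ _ < k ] s) (∑ᴾ-const n a) ⟩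
    ∑[ _ < k ] (+ (k ^ n) * a)   ≡⟨ ∑-const k _ ⟩
    + k * (+ (k ^ n) * a)        ≡⟨ ℤ.*-assoc (+ k) (+ (k ^ n)) a ⟨
    + k * + (k ^ n) * a          ≡⟨ cong (_* a) (ℤ.pos-* k (k ^ n)) ⟨
    + (k ^ suc n) * a            ∎
    where open ≡-Reasoning

  ∑ᴾ-zero : ∀ n → ∑ᴾ {n} {k} (λ _ → 0ℤ) ≡ 0ℤ
  ∑ᴾ-zero n = trans (∑ᴾ-const n 0ℤ) (ℤ.*-zeroʳ (+ (k ^ n)))

  ∑ᴾ-∑-comm : ∀ {n m} (h : Partition n k → Fin m → ℤ) →
    ∑ᴾ (λ f → ∑[ i < m ] h f i) ≡ ∑[ i < m ] ∑ᴾ (λ f → h f i)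
  ∑ᴾ-∑-comm {zero}  h = refl
  ∑ᴾ-∑-comm {suc n} h =
    trans (sum-cong-≗ (λ c → ∑ᴾ-∑-comm (h ∘ (c V.∷_))))
          (∑-comm (λ c i → ∑ᴾ (λ f → h (c V.∷ f) i)))

  ∑ᴾ-∑ˡ-comm : ∀ {A : Set} {n} xs (h : Partition n k → A → ℤ) →
    ∑ᴾ (λ f → ∑ˡ xs (h f)) ≡ ∑ˡ xs (λ x → ∑ᴾ (λ f → h f x))
  ∑ᴾ-∑ˡ-comm {n = n} []       h = ∑ᴾ-zero n
  ∑ᴾ-∑ˡ-comm         (x ∷ xs) h =
    trans (∑ᴾ-distrib-+ (λ f → h f x) (λ f → ∑ˡ xs (h f)))
          (cong (λ s → ∑ᴾ (λ f → h f x) + s) (∑ᴾ-∑ˡ-comm xs h))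

  ∑ᴾ-mono-≤ : ∀ {n} {g h : Partition n k → ℤ} → (∀ f → g f ≤ h f) → ∑ᴾ g ≤ ∑ᴾ h
  ∑ᴾ-mono-≤ {zero}  g≤h = g≤h _
  ∑ᴾ-mono-≤ {suc n} g≤h = ∑-mono-≤ (λ c → ∑ᴾ-mono-≤ (g≤h ∘ (c V.∷_)))

  ∑ᴾ-<-witness : ∀ {n} (g h : Partition n k → ℤ) → ∑ᴾ g < ∑ᴾ h → Σ[ f ∈ Partition n k ] g f < h f
  ∑ᴾ-<-witness {zero}  g h ∑g<∑h = (λ ()) , ∑g<∑h
  ∑ᴾ-<-witness {suc n} g h ∑g<∑h =
    let c , ∑g<∑h′ = ∑-<-witness _ _ ∑g<∑h
        f , gf<hf   = ∑ᴾ-<-witness (g ∘ (c V.∷_)) (h ∘ (c V.∷_)) ∑g<∑h′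
    in c V.∷ f , gf<hf

∑ᴾ-nonneg : ∀ {n k} {h : Partition n k → ℤ} → (∀ f → 0ℤ ≤ h f) → 0ℤ ≤ ∑ᴾ h
∑ᴾ-nonneg {n} {k} {h} h≥0 = subst (_≤ ∑ᴾ h) (∑ᴾ-zero {k} n) (∑ᴾ-mono-≤ h≥0)

pythagoras : ∀ {A : Set} {n k} (t : A → Partition n k → ℤ) xs →
  AllPairs (λ p q → ∑ᴾ (λ f → t p f * t q f) ≡ 0ℤ) xs →
  ∑ᴾ (λ f → ∑ˡ xs (λ p → t p f) * ∑ˡ xs (λ p → t p f)) ≡ ∑ˡ xs (λ p → ∑ᴾ (λ f → t p f * t p f))
pythagoras {n = n} t []       []               = ∑ᴾ-zero n
pythagoras {n = n} {k} t (x ∷ xs) (x⊥xs ∷ xs-orth) = begin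
  ∑ᴾ (λ f → (T f + R f) * (T f + R f))
    ≡⟨ ∑ᴾ-cong (λ f → expand (T f) (R f)) ⟩
  ∑ᴾ (λ f → T f * T f + (+ 2 * (T f * R f) + R f * R f))
    ≡⟨ ∑ᴾ-distrib-+ (λ f → T f * T f) (λ f → + 2 * (T f * R f) + R f * R f) ⟩
  ∑ᴾ (λ f → T f * T f) + ∑ᴾ (λ f → + 2 * (T f * R f) + R f * R f)
    ≡⟨ cong (λ s → ∑ᴾ (λ f → T f * T f) + s)
            (∑ᴾ-distrib-+ (λ f → + 2 * (T f * R f)) (λ f → R f * R f)) ⟩
  ∑ᴾ (λ f → T f * T f) + (∑ᴾ (λ f → + 2 * (T f * R f)) + ∑ᴾ (λ f → R f * R f))
    ≡⟨ cong (λ s → ∑ᴾ (λ f → T f * T f) + (s + ∑ᴾ (λ f → R f * R f))) cross-term ⟩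
  ∑ᴾ (λ f → T f * T f) + (0ℤ + ∑ᴾ (λ f → R f * R f))
    ≡⟨ cong (λ s → ∑ᴾ (λ f → T f * T f) + s) (trans (ℤ.+-identityˡ _) (pythagoras t xs xs-orth)) ⟩
  ∑ᴾ (λ f → T f * T f) + ∑ˡ xs (λ p → ∑ᴾ (λ f → t p f * t p f)) ∎
  where
  open ≡-Reasoning
  T R : Partition n k → ℤ
  T = t x
  R f = ∑ˡ xs (λ p → t p f)
  expand : ∀ a b → (a + b) * (a + b) ≡ a * a + (+ 2 * (a * b) + b * b)
  expand = solve-∀
  cross-term : ∑ᴾ (λ f → + 2 * (T f * R f)) ≡ 0ℤ
  cross-term = begin
    ∑ᴾ (λ f → + 2 * (T f * R f))
      ≡⟨ *-distribˡ-∑ᴾ (+ 2) (λ f → T f * R f) ⟨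
    + 2 * ∑ᴾ (λ f → T f * R f)
      ≡⟨ cong (+ 2 *_) (∑ᴾ-cong (λ f → *-distribˡ-∑ˡ (T f) xs (λ p → t p f))) ⟩
    + 2 * ∑ᴾ (λ f → ∑ˡ xs (λ p → T f * t p f))
      ≡⟨ cong (+ 2 *_) (∑ᴾ-∑ˡ-comm xs (λ f p → T f * t p f)) ⟩
    + 2 * ∑ˡ xs (λ p → ∑ᴾ (λ f → T f * t p f))
      ≡⟨ cong (+ 2 *_) (∑ˡ-zero x⊥xs) ⟩
    + 2 * 0ℤ
      ≡⟨ ℤ.*-zeroʳ (+ 2) ⟩
    0ℤ ∎

_[_]≔_ : ∀ {n k} → Partition n k → Fin n → Fin k → Partition n k
f [ zero  ]≔ c = c V.∷ V.tail f
f [ suc w ]≔ c = V.head f V.∷ (V.tail f [ w ]≔ c)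

[]≔-updates : ∀ {n k} (f : Partition n k) w c → (f [ w ]≔ c) w ≡ c
[]≔-updates f zero    c = refl
[]≔-updates f (suc w) c = []≔-updates (V.tail f) w c

[]≔-minimal : ∀ {n k} (f : Partition n k) {u w} c → u ≢ w → (f [ w ]≔ c) u ≡ f u
[]≔-minimal f {zero}  {zero}  c u≢w = contradiction refl u≢w
[]≔-minimal f {suc u} {zero}  c u≢w = refl
[]≔-minimal f {zero}  {suc w} c u≢w = refl
[]≔-minimal f {suc u} {suc w} c u≢w = []≔-minimal (V.tail f) c (u≢w ∘ cong suc)

∑ᴾ-resample : ∀ {n k} (w : Fin n) (h : Partition n k → ℤ) →
  ∑ᴾ (λ f → ∑[ c < k ] h (f [ w ]≔ c)) ≡ + k * ∑ᴾ h
∑ᴾ-resample {k = k} zero    h = begin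
  ∑[ _ < k ] ∑ᴾ (λ f → ∑[ c < k ] h (c V.∷ f))
    ≡⟨ cong (λ s → ∑[ _ < k ] s) (∑ᴾ-∑-comm (λ f c → h (c V.∷ f))) ⟩
  ∑[ _ < k ] ∑ᴾ h
    ≡⟨ ∑-const k (∑ᴾ h) ⟩
  + k * ∑ᴾ h ∎
  where open ≡-Reasoning
∑ᴾ-resample {k = k} (suc w) h =
  trans (sum-cong-≗ (λ c → ∑ᴾ-resample w (h ∘ (c V.∷_))))
        (sym (*-distribˡ-sum (+ k) (λ c → ∑ᴾ (h ∘ (c V.∷_)))))

centred : ∀ {k} → Fin k → Fin k → ℤ
centred {k} a b = + k * 𝟙 (does (a ≟ b)) - 1ℤ

does-≟-sym : ∀ {k} (a b : Fin k) → does (a ≟ b) ≡ does (b ≟ a)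
does-≟-sym a b with a ≟ b | b ≟ a
... | yes _   | yes _   = refl
... | no  _   | no  _   = refl
... | yes a≡b | no  b≢a = contradiction (sym a≡b) b≢a
... | no  a≢b | yes b≡a = contradiction (sym b≡a) a≢b

centred-sym : ∀ {k} (a b : Fin k) → centred a b ≡ centred b a
centred-sym {k} a b = cong (λ x → + k * 𝟙 x - 1ℤ) (does-≟-sym a b)

∑-𝟙-≟ : ∀ {k} (a : Fin k) → ∑[ b < k ] 𝟙 (does (a ≟ b)) ≡ 1ℤ
∑-𝟙-≟ {suc k} zero    = cong (λ s → 1ℤ + s) (trans (∑-const k 0ℤ) (ℤ.*-zeroʳ (+ k)))
∑-𝟙-≟ {suc k} (suc a) = trans (ℤ.+-identityˡ _) (∑-𝟙-≟ a)

∑-centred : ∀ {k} (a : Fin k) → ∑[ b < k ] centred a b ≡ 0ℤ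
∑-centred {k} a = begin
  ∑[ b < k ] (+ k * 𝟙 (does (a ≟ b)) - 1ℤ)
    ≡⟨ ∑-distrib-+ (λ b → + k * 𝟙 (does (a ≟ b))) (λ _ → - 1ℤ) ⟩
  ∑[ b < k ] (+ k * 𝟙 (does (a ≟ b))) + ∑[ b < k ] (- 1ℤ)
    ≡⟨ cong₂ _+_ (sym (*-distribˡ-sum (+ k) (λ b → 𝟙 (does (a ≟ b))))) (∑-const k (- 1ℤ)) ⟩
  + k * ∑[ b < k ] 𝟙 (does (a ≟ b)) + + k * - 1ℤ
    ≡⟨ cong (λ s → + k * s + + k * - 1ℤ) (∑-𝟙-≟ a) ⟩
  + k * 1ℤ + + k * - 1ℤ
    ≡⟨ cancel (+ k) ⟩
  0ℤ ∎
  where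
  open ≡-Reasoning
  cancel : ∀ x → x * 1ℤ + x * - 1ℤ ≡ 0ℤ
  cancel = solve-∀

centred-square : ∀ {k} (a b : Fin k) → centred a b * centred a b ≡ (+ k - + 2) * centred a b + (+ k - 1ℤ)
centred-square {k} a b with does (a ≟ b)
... | true  = at (+ k)
  where
  at : ∀ K → (K * 1ℤ - 1ℤ) * (K * 1ℤ - 1ℤ) ≡ (K - + 2) * (K * 1ℤ - 1ℤ) + (K - 1ℤ)
  at = solve-∀
... | false = at (+ k)
  where
  at : ∀ K → (K * 0ℤ - 1ℤ) * (K * 0ℤ - 1ℤ) ≡ (K - + 2) * (K * 0ℤ - 1ℤ) + (K - 1ℤ)
  at = solve-∀

∑-centred² : ∀ {k} (a : Fin k) → ∑[ b < k ] (centred a b * centred a b) ≡ + k * (+ k - 1ℤ)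
∑-centred² {k} a = begin
  ∑[ b < k ] (centred a b * centred a b)
    ≡⟨ sum-cong-≗ (centred-square a) ⟩
  ∑[ b < k ] ((+ k - + 2) * centred a b + (+ k - 1ℤ))
    ≡⟨ ∑-distrib-+ (λ b → (+ k - + 2) * centred a b) (λ _ → + k - 1ℤ) ⟩
  ∑[ b < k ] ((+ k - + 2) * centred a b) + ∑[ b < k ] (+ k - 1ℤ)
    ≡⟨ cong₂ _+_ (sym (*-distribˡ-sum (+ k - + 2) (centred a))) (∑-const k (+ k - 1ℤ)) ⟩
  (+ k - + 2) * ∑[ b < k ] centred a b + + k * (+ k - 1ℤ)
    ≡⟨ cong (λ s → (+ k - + 2) * s + + k * (+ k - 1ℤ)) (∑-centred a) ⟩
  (+ k - + 2) * 0ℤ + + k * (+ k - 1ℤ)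
    ≡⟨ trans (cong (_+ + k * (+ k - 1ℤ)) (ℤ.*-zeroʳ (+ k - + 2))) (ℤ.+-identityˡ _) ⟩
  + k * (+ k - 1ℤ) ∎
  where open ≡-Reasoning

module _ {n k : ℕ} .{{_ : NonZero k}} where

  ∑ᴾ-centred-orthogonal : ∀ {u v z w : Fin n} → u ≢ w → v ≢ w → z ≢ w →
    ∑ᴾ {n} {k} (λ f → centred (f u) (f v) * centred (f z) (f w)) ≡ 0ℤ
  ∑ᴾ-centred-orthogonal {u} {v} {z} {w} u≢w v≢w z≢w = ℤ.*-cancelˡ-≡ (+ k) _ _ (begin
    + k * ∑ᴾ (λ f → centred (f u) (f v) * centred (f z) (f w))
      ≡⟨ ∑ᴾ-resample w _ ⟨
    ∑ᴾ (λ f → ∑[ c < k ] (centred (g f c u) (g f c v) * centred (g f c z) (g f c w)))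
      ≡⟨ ∑ᴾ-cong (λ f → sum-cong-≗ (resampled f)) ⟩
    ∑ᴾ (λ f → ∑[ c < k ] (centred (f u) (f v) * centred (f z) c))
      ≡⟨ ∑ᴾ-cong (λ f → trans (sym (*-distribˡ-sum (centred (f u) (f v)) (centred (f z))))
                               (cong (centred (f u) (f v) *_) (∑-centred (f z)))) ⟩
    ∑ᴾ (λ f → centred (f u) (f v) * 0ℤ)
      ≡⟨ ∑ᴾ-cong (λ f → ℤ.*-zeroʳ (centred (f u) (f v))) ⟩
    ∑ᴾ {n} {k} (λ _ → 0ℤ)
      ≡⟨ ∑ᴾ-zero n ⟩
    0ℤ
      ≡⟨ ℤ.*-zeroʳ (+ k) ⟨
    + k * 0ℤ ∎)
    where
    open ≡-Reasoning
    g : Partition n k → Fin k → Partition n k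
    g f c = f [ w ]≔ c
    resampled : ∀ f c → centred (g f c u) (g f c v) * centred (g f c z) (g f c w)
                      ≡ centred (f u) (f v) * centred (f z) c
    resampled f c rewrite []≔-minimal f c u≢w | []≔-minimal f c v≢w | []≔-minimal f c z≢w
                        | []≔-updates f w c = refl

  ∑ᴾ-centred² : ∀ {u v : Fin n} → u ≢ v →
    ∑ᴾ {n} {k} (λ f → centred (f u) (f v) * centred (f u) (f v)) ≡ + (k ^ n) * (+ k - 1ℤ)
  ∑ᴾ-centred² {u} {v} u≢v = ℤ.*-cancelˡ-≡ (+ k) _ _ (begin
    + k * ∑ᴾ (λ f → centred (f u) (f v) * centred (f u) (f v))
      ≡⟨ ∑ᴾ-resample v _ ⟨
    ∑ᴾ (λ f → ∑[ c < k ] (centred (g f c u) (g f c v) * centred (g f c u) (g f c v)))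
      ≡⟨ ∑ᴾ-cong (λ f → sum-cong-≗ (resampled f)) ⟩
    ∑ᴾ (λ f → ∑[ c < k ] (centred (f u) c * centred (f u) c))
      ≡⟨ ∑ᴾ-cong (λ f → ∑-centred² (f u)) ⟩
    ∑ᴾ {n} {k} (λ _ → + k * (+ k - 1ℤ))
      ≡⟨ ∑ᴾ-const n _ ⟩
    + (k ^ n) * (+ k * (+ k - 1ℤ))
      ≡⟨ swap (+ (k ^ n)) (+ k) _ ⟩
    + k * (+ (k ^ n) * (+ k - 1ℤ)) ∎)
    where
    open ≡-Reasoning
    g : Partition n k → Fin k → Partition n k
    g f c = f [ v ]≔ c
    resampled : ∀ f c → centred (g f c u) (g f c v) * centred (g f c u) (g f c v)
                      ≡ centred (f u) c * centred (f u) c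
    resampled f c rewrite []≔-minimal f c u≢v | []≔-updates f v c = refl
    swap : ∀ x y z → x * (y * z) ≡ y * (x * z)
    swap = solve-∀

Ascending : ∀ {n} → Fin n × Fin n → Set
Ascending (u , v) = u Fin.< v

ascending? : ∀ {n} → Decidable (Ascending {n})
ascending? (u , v) = toℕ u ℕ.<? toℕ v

allPairs : ∀ n → List (Fin n × Fin n)
allPairs n = cartesianProduct (allFin n) (allFin n)

mutual
  -- The filter inside the definition of orderedPairs is a local function; unification names it.
  keepAscending : ∀ {n} → List (Fin n × Fin n) → List (Fin n × Fin n)
  keepAscending = _

  orderedPairs≡keepAscending : ∀ n → orderedPairs n ≡ keepAscending (allPairs n)
  orderedPairs≡keepAscending n with allPairs n
  ... | ps = refl

keepAscending≡filter : ∀ {n} (ps : List (Fin n × Fin n)) → keepAscending ps ≡ filter ascending? ps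
keepAscending≡filter []             = refl
keepAscending≡filter ((u , v) ∷ ps) with toℕ u ℕ.<ᵇ toℕ v
... | true  = cong ((u , v) ∷_) (keepAscending≡filter ps)
... | false = keepAscending≡filter ps

orderedPairs≡filter : ∀ n → orderedPairs n ≡ filter ascending? (allPairs n)
orderedPairs≡filter n = trans (orderedPairs≡keepAscending n) (keepAscending≡filter (allPairs n))

orderedPairs-ascending : ∀ n → All Ascending (orderedPairs n)
orderedPairs-ascending n =
  subst (All Ascending) (sym (orderedPairs≡filter n)) (All.all-filter ascending? (allPairs n))

orderedPairs-unique : ∀ n → Unique (orderedPairs n)
orderedPairs-unique n = subst Unique (sym (orderedPairs≡filter n))
  (Unique.filter⁺ ascending? (Unique.cartesianProduct⁺ (Unique.allFin⁺ n) (Unique.allFin⁺ n)))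

ascending-≢-escape : ∀ {n} {u v x y : Fin n} → Ascending (u , v) → Ascending (x , y) → (u , v) ≢ (x , y) →
  (u ≢ y × v ≢ y) ⊎ (u ≢ x × v ≢ x)
ascending-≢-escape {u = u} {v} {x} {y} u<v x<y uv≢xy with u ≟ y | v ≟ y | u ≟ x | v ≟ x
... | no u≢y    | no v≢y    | _         | _         = inj₁ (u≢y , v≢y)
... | _         | _         | no u≢x    | no v≢x    = inj₂ (u≢x , v≢x)
... | yes refl  | _         | yes refl  | _         = contradiction x<y (Fin.<-irrefl refl)
... | yes refl  | _         | _         | yes refl  = contradiction x<y (Fin.<-asym u<v)
... | _         | yes refl  | yes refl  | _         = contradiction refl uv≢xy
... | _         | yes refl  | _         | yes refl  = contradiction x<y (Fin.<-irrefl refl)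

centredEdge : ∀ {n k} → Fin n × Fin n → Partition n k → ℤ
centredEdge (u , v) f = centred (f u) (f v)

module _ {n k : ℕ} .{{_ : NonZero k}} where

  ∑ᴾ-centredEdge-orthogonal : ∀ {p q : Fin n × Fin n} → Ascending p → Ascending q → p ≢ q →
    ∑ᴾ {n} {k} (λ f → centredEdge p f * centredEdge q f) ≡ 0ℤ
  ∑ᴾ-centredEdge-orthogonal {u , v} {x , y} u<v x<y p≢q with ascending-≢-escape u<v x<y p≢q
  ... | inj₁ (u≢y , v≢y) = ∑ᴾ-centred-orthogonal u≢y v≢y (Fin.<⇒≢ x<y)
  ... | inj₂ (u≢x , v≢x) = trans
    (∑ᴾ-cong (λ f → cong (centred (f u) (f v) *_) (centred-sym (f x) (f y))))
    (∑ᴾ-centred-orthogonal u≢x v≢x (≢-sym (Fin.<⇒≢ x<y)))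

isEdge : ∀ {n} → Graph n → Fin n × Fin n → Bool
isEdge G (u , v) = adj G u v

defectTerm : ∀ {n k} → Graph n → Fin n × Fin n → Partition n k → ℤ
defectTerm G p f = 𝟙 (isEdge G p) * centredEdge p f

defect : ∀ {n k} → Graph n → Partition n k → ℤ
defect {n} G f = ∑ˡ (orderedPairs n) (λ p → defectTerm G p f)

defect≡ : ∀ {n k} (G : Graph n) (f : Partition n k) →
  defect G f ≡ (+ k - 1ℤ) * + edgeCount G - + k * + cutCount G f
defect≡ {n} {k} G f = begin
  ∑ˡ P (λ p → defectTerm G p f)
    ≡⟨ ∑ˡ-cong (All.universal (λ p → term p) P) ⟩
  ∑ˡ P (λ p → (+ k - 1ℤ) * 𝟙 (isEdge G p) - + k * 𝟙 (cut p))
    ≡⟨ ∑ˡ-linear P (+ k - 1ℤ) (+ k) (𝟙 ∘ isEdge G) (𝟙 ∘ cut) ⟩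
  (+ k - 1ℤ) * ∑ˡ P (𝟙 ∘ isEdge G) - + k * ∑ˡ P (𝟙 ∘ cut)
    ≡⟨ cong₂ (λ a b → (+ k - 1ℤ) * a - + k * b) (count≡∑ˡ𝟙 (isEdge G) P) (count≡∑ˡ𝟙 cut P) ⟨
  (+ k - 1ℤ) * + edgeCount G - + k * + cutCount G f ∎
  where
  open ≡-Reasoning
  P : List (Fin n × Fin n)
  P = orderedPairs n
  cut : Fin n × Fin n → Bool
  cut (u , v) = adj G u v ∧ not (does (f u ≟ f v))
  term : ∀ p → defectTerm G p f ≡ (+ k - 1ℤ) * 𝟙 (isEdge G p) - + k * 𝟙 (cut p)
  term (u , v) with adj G u v | does (f u ≟ f v)
  ... | true  | true  = edge-mono (+ k)
    where
    edge-mono : ∀ K → 1ℤ * (K * 1ℤ - 1ℤ) ≡ (K - 1ℤ) * 1ℤ - K * 0ℤ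
    edge-mono = solve-∀
  ... | true  | false = edge-cut (+ k)
    where
    edge-cut : ∀ K → 1ℤ * (K * 0ℤ - 1ℤ) ≡ (K - 1ℤ) * 1ℤ - K * 1ℤ
    edge-cut = solve-∀
  ... | false | b     = non-edge (+ k) (𝟙 b)
    where
    non-edge : ∀ K x → 0ℤ * (K * x - 1ℤ) ≡ (K - 1ℤ) * 0ℤ - K * 0ℤ
    non-edge = solve-∀

module _ {n k : ℕ} .{{_ : NonZero k}} (G : Graph n) where

  ∑ᴾ-defectTerm-* : ∀ p q → ∑ᴾ {n} {k} (λ f → defectTerm G p f * defectTerm G q f)
    ≡ 𝟙 (isEdge G p) * 𝟙 (isEdge G q) * ∑ᴾ (λ f → centredEdge p f * centredEdge q f)
  ∑ᴾ-defectTerm-* p q = trans (∑ᴾ-cong (λ f → regroup a b (centredEdge p f) (centredEdge q f)))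
                              (sym (*-distribˡ-∑ᴾ (a * b) (λ f → centredEdge p f * centredEdge q f)))
    where
    a b : ℤ
    a = 𝟙 (isEdge G p)
    b = 𝟙 (isEdge G q)
    regroup : ∀ a b x y → a * x * (b * y) ≡ a * b * (x * y)
    regroup = solve-∀

  ∑ᴾ-defectTerm-orthogonal : ∀ {p q} → Ascending p → Ascending q → p ≢ q →
    ∑ᴾ {n} {k} (λ f → defectTerm G p f * defectTerm G q f) ≡ 0ℤ
  ∑ᴾ-defectTerm-orthogonal {p} {q} p↑ q↑ p≢q = begin
    ∑ᴾ (λ f → defectTerm G p f * defectTerm G q f)
      ≡⟨ ∑ᴾ-defectTerm-* p q ⟩
    𝟙 (isEdge G p) * 𝟙 (isEdge G q) * ∑ᴾ (λ f → centredEdge p f * centredEdge q f)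
      ≡⟨ cong (𝟙 (isEdge G p) * 𝟙 (isEdge G q) *_) (∑ᴾ-centredEdge-orthogonal p↑ q↑ p≢q) ⟩
    𝟙 (isEdge G p) * 𝟙 (isEdge G q) * 0ℤ
      ≡⟨ ℤ.*-zeroʳ (𝟙 (isEdge G p) * 𝟙 (isEdge G q)) ⟩
    0ℤ ∎
    where open ≡-Reasoning

  defectTerms-orthogonal : ∀ {ps} → All Ascending ps → Unique ps →
    AllPairs (λ p q → ∑ᴾ {n} {k} (λ f → defectTerm G p f * defectTerm G q f) ≡ 0ℤ) ps
  defectTerms-orthogonal []         []                = []
  defectTerms-orthogonal (p↑ ∷ ps↑) (p∉ps ∷ ps-unique) =
    All.zipWith (λ (q↑ , p≢q) → ∑ᴾ-defectTerm-orthogonal p↑ q↑ p≢q) (ps↑ , p∉ps)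
    ∷ defectTerms-orthogonal ps↑ ps-unique

  ∑ᴾ-defectTerm² : ∀ {p} → Ascending p →
    ∑ᴾ {n} {k} (λ f → defectTerm G p f * defectTerm G p f) ≡ + (k ^ n) * (+ k - 1ℤ) * 𝟙 (isEdge G p)
  ∑ᴾ-defectTerm² {p} p↑ = begin
    ∑ᴾ (λ f → defectTerm G p f * defectTerm G p f)
      ≡⟨ ∑ᴾ-defectTerm-* p p ⟩
    𝟙 (isEdge G p) * 𝟙 (isEdge G p) * ∑ᴾ (λ f → centredEdge p f * centredEdge p f)
      ≡⟨ cong₂ _*_ (𝟙-idem (isEdge G p)) (∑ᴾ-centred² (Fin.<⇒≢ p↑)) ⟩
    𝟙 (isEdge G p) * (+ (k ^ n) * (+ k - 1ℤ))
      ≡⟨ ℤ.*-comm (𝟙 (isEdge G p)) _ ⟩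
    + (k ^ n) * (+ k - 1ℤ) * 𝟙 (isEdge G p) ∎
    where
    open ≡-Reasoning
    𝟙-idem : ∀ b → 𝟙 b * 𝟙 b ≡ 𝟙 b
    𝟙-idem true  = refl
    𝟙-idem false = refl

  ∑ᴾ-defect² : ∑ᴾ {n} {k} (λ f → defect G f * defect G f) ≡ + (k ^ n) * (+ k - 1ℤ) * + edgeCount G
  ∑ᴾ-defect² = begin
    ∑ᴾ (λ f → defect G f * defect G f)
      ≡⟨ pythagoras (defectTerm G) P
           (defectTerms-orthogonal (orderedPairs-ascending n) (orderedPairs-unique n)) ⟩
    ∑ˡ P (λ p → ∑ᴾ (λ f → defectTerm G p f * defectTerm G p f))
      ≡⟨ ∑ˡ-cong (All.map ∑ᴾ-defectTerm² (orderedPairs-ascending n)) ⟩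
    ∑ˡ P (λ p → E * 𝟙 (isEdge G p))
      ≡⟨ *-distribˡ-∑ˡ E P (𝟙 ∘ isEdge G) ⟨
    E * ∑ˡ P (𝟙 ∘ isEdge G)
      ≡⟨ cong (E *_) (count≡∑ˡ𝟙 (isEdge G) P) ⟨
    E * + edgeCount G ∎
    where
    open ≡-Reasoning
    P : List (Fin n × Fin n)
    P = orderedPairs n
    E : ℤ
    E = + (k ^ n) * (+ k - 1ℤ)

markov : ∀ {n k} (X : Partition n k → ℤ) B → (∀ f → 0ℤ ≤ X f) →
  (1ℤ + B) * ∑ᴾ (λ f → 𝟙 (does (B ℤ.<? X f))) ≤ ∑ᴾ X
markov X B X≥0 = subst (_≤ ∑ᴾ X) (sym (*-distribˡ-∑ᴾ (1ℤ + B) (λ f → 𝟙 (does (B ℤ.<? X f)))))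
                       (∑ᴾ-mono-≤ pointwise)
  where
  pointwise : ∀ f → (1ℤ + B) * 𝟙 (does (B ℤ.<? X f)) ≤ X f
  pointwise f with B ℤ.<? X f
  ... | yes B<X = subst (_≤ X f) (sym (ℤ.*-identityʳ (1ℤ + B))) (ℤ.i<j⇒suc[i]≤j B<X)
  ... | no  _   = subst (_≤ X f) (sym (ℤ.*-zeroʳ (1ℤ + B))) (X≥0 f)

union-bound : ∀ {ℓ n k} (bad : Fin ℓ → Partition n k → Bool) →
  ∑[ i < ℓ ] ∑ᴾ (λ f → 𝟙 (bad i f)) < + (k ^ n) → Σ[ f ∈ Partition n k ] ∀ i → bad i f ≡ false
union-bound {ℓ} {n} {k} bad few =
  let f , ∑𝟙<1 = ∑ᴾ-<-witness ∑𝟙 (λ _ → 1ℤ) fewer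
  in  f , λ i → 𝟙<1⇒false (ℤ.≤-<-trans (term≤∑ (λ j → 𝟙-nonneg (bad j f)) i) ∑𝟙<1)
  where
  ∑𝟙 : Partition n k → ℤ
  ∑𝟙 f = ∑[ i < ℓ ] 𝟙 (bad i f)
  fewer : ∑ᴾ ∑𝟙 < ∑ᴾ {n} {k} (λ _ → 1ℤ)
  fewer = subst₂ _<_ (sym (∑ᴾ-∑-comm (λ f i → 𝟙 (bad i f))))
                     (sym (trans (∑ᴾ-const n 1ℤ) (ℤ.*-identityʳ (+ (k ^ n))))) few

markov-cancel : ∀ c d s N B → c ℕ.* d ℕ.≤ B → (1 ℕ.+ B) ℕ.* s ℕ.≤ N ℕ.* d → c ℕ.* s ℕ.≤ N
markov-cancel c zero s N B _ h =
  subst (λ x → c ℕ.* x ℕ.≤ N) (sym (ℕ.n≤0⇒n≡0 s≤0)) (ℕ.≤-trans (ℕ.≤-reflexive (ℕ.*-zeroʳ c)) z≤n)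
  where
  s≤0 : s ℕ.≤ 0
  s≤0 = ℕ.≤-trans (ℕ.m≤n*m s (1 ℕ.+ B)) (ℕ.≤-trans h (ℕ.≤-reflexive (ℕ.*-zeroʳ N)))
markov-cancel c d@(suc _) s N B cd≤B h = ℕ.*-cancelˡ-≤ d (begin
  d ℕ.* (c ℕ.* s)      ≡⟨ rearrange d c s ⟩
  c ℕ.* d ℕ.* s        ≤⟨ ℕ.*-monoˡ-≤ s (ℕ.m≤n⇒m≤1+n cd≤B) ⟩
  (1 ℕ.+ B) ℕ.* s      ≤⟨ h ⟩
  N ℕ.* d              ≡⟨ ℕ.*-comm N d ⟩
  d ℕ.* N              ∎)
  where
  open ℕ.≤-Reasoning
  rearrange : ∀ d c s → d ℕ.* (c ℕ.* s) ≡ c ℕ.* d ℕ.* s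
  rearrange = ℕ-solve-∀

∑-<-when-small : ∀ {ℓ N} .{{_ : NonZero ℓ}} .{{_ : NonZero N}} (s : Fin ℓ → ℤ) →
  (∀ i → + (2 ℕ.* ℓ) * s i ≤ + N) → ∑[ i < ℓ ] s i < + N
∑-<-when-small {ℓ} {N} s small = ℤ.*-cancelˡ-<-nonNeg (+ (2 ℕ.* ℓ)) (begin-strict
  + (2 ℕ.* ℓ) * ∑[ i < ℓ ] s i    ≡⟨ *-distribˡ-sum (+ (2 ℕ.* ℓ)) s ⟩
  ∑[ i < ℓ ] (+ (2 ℕ.* ℓ) * s i)  ≤⟨ ∑-mono-≤ small ⟩
  ∑[ i < ℓ ] (+ N)                ≡⟨ ∑-const ℓ (+ N) ⟩
  + ℓ * + N                       ≡⟨ ℤ.pos-* ℓ N ⟨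
  + (ℓ ℕ.* N)                     <⟨ +<+ (ℕ.m<m+n (ℓ ℕ.* N) ℓN>0) ⟩
  + (ℓ ℕ.* N ℕ.+ ℓ ℕ.* N)         ≡⟨ cong +_ (double ℓ N) ⟩
  + (2 ℕ.* ℓ ℕ.* N)               ≡⟨ ℤ.pos-* (2 ℕ.* ℓ) N ⟩
  + (2 ℕ.* ℓ) * + N               ∎)
  where
  open ℤ.≤-Reasoning
  ℓN>0 : ℓ ℕ.* N ℕ.> 0
  ℓN>0 = ℕ.>-nonZero⁻¹ (ℓ ℕ.* N) {{ℕ.m*n≢0 ℓ N}}
  double : ∀ ℓ N → ℓ ℕ.* N ℕ.+ ℓ ℕ.* N ≡ 2 ℕ.* ℓ ℕ.* N
  double = ℕ-solve-∀

exceeds : ∀ {n k} → ℕ → Graph n → Partition n k → Bool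
exceeds B G f = does (+ B ℤ.<? defect G f * defect G f)

rarely-exceeds : ∀ {n} k' ℓ (G : Graph n) →
  let k = suc k' in
  + (2 ℕ.* ℓ) * ∑ᴾ (λ f → 𝟙 (exceeds (k ℕ.* k ℕ.* (2 ℕ.* ℓ ℕ.* edgeCount G)) G f)) ≤ + (k ^ n)
rarely-exceeds {n} k' ℓ G = scale (∑ᴾ-nonneg (λ f → 𝟙-nonneg (exceeds B G f))) (begin
  (1ℤ + + B) * ∑ᴾ (λ f → 𝟙 (exceeds B G f))
    ≤⟨ markov (λ f → defect G f * defect G f) (+ B) (λ f → square-nonneg (defect G f)) ⟩
  ∑ᴾ (λ f → defect G f * defect G f)
    ≡⟨ ∑ᴾ-defect² G ⟩
  + N * + k' * + m
    ≡⟨ ℤ.*-assoc (+ N) (+ k') (+ m) ⟩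
  + N * (+ k' * + m)
    ≡⟨ cong (+ N *_) (ℤ.pos-* k' m) ⟨
  + N * + (k' ℕ.* m)
    ≡⟨ ℤ.pos-* N (k' ℕ.* m) ⟨
  + (N ℕ.* (k' ℕ.* m)) ∎)
  where
  open ℤ.≤-Reasoning
  k m N B : ℕ
  k = suc k'
  m = edgeCount G
  N = k ^ n
  B = k ℕ.* k ℕ.* (2 ℕ.* ℓ ℕ.* m)
  c*d≤B : 2 ℕ.* ℓ ℕ.* (k' ℕ.* m) ℕ.≤ B
  c*d≤B = ℕ.≤-trans (ℕ.≤-reflexive (rearrange ℓ k' m))
                    (ℕ.*-monoˡ-≤ (2 ℕ.* ℓ ℕ.* m) (ℕ.≤-trans (ℕ.n≤1+n k') (ℕ.m≤m*n k k)))
    where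
    rearrange : ∀ ℓ k' m → 2 ℕ.* ℓ ℕ.* (k' ℕ.* m) ≡ k' ℕ.* (2 ℕ.* ℓ ℕ.* m)
    rearrange = ℕ-solve-∀
  scale : ∀ {S} → 0ℤ ≤ S → (1ℤ + + B) * S ≤ + (N ℕ.* (k' ℕ.* m)) → + (2 ℕ.* ℓ) * S ≤ + N
  scale (+≤+ {n = s} _) bound = subst (_≤ + N) (ℤ.pos-* (2 ℕ.* ℓ) s)
    (+≤+ (markov-cancel (2 ℕ.* ℓ) (k' ℕ.* m) s N B c*d≤B
           (ℤ.drop‿+≤+ (subst (_≤ _) (sym (ℤ.pos-* (1 ℕ.+ B) s)) bound))))

∸-square-≤ : ∀ a b {B} → (+ a - + b) * (+ a - + b) ≤ + B → (a ℕ.∸ b) ℕ.* (a ℕ.∸ b) ℕ.≤ B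
∸-square-≤ a b sq≤B with b ℕ.≤? a
... | yes b≤a = ℤ.drop‿+≤+ (subst (_≤ _) square sq≤B)
  where
  difference : + a - + b ≡ + (a ℕ.∸ b)
  difference = trans (ℤ.[+m]-[+n]≡m⊖n a b) (ℤ.⊖-≥ b≤a)
  square : (+ a - + b) * (+ a - + b) ≡ + ((a ℕ.∸ b) ℕ.* (a ℕ.∸ b))
  square = trans (cong (λ x → x * x) difference) (sym (ℤ.pos-* (a ℕ.∸ b) (a ℕ.∸ b)))
... | no  b≰a rewrite ℕ.m≤n⇒m∸n≡0 (ℕ.<⇒≤ (ℕ.≰⇒> b≰a)) = z≤n

¬exceeds⇒≤ : ∀ {n k} {B} {G : Graph n} {f : Partition n k} →
  exceeds B G f ≡ false → defect G f * defect G f ≤ + B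
¬exceeds⇒≤ {B = B} {G} {f} ¬exceeds with + B ℤ.<? defect G f * defect G f
... | no B≮d² = ℤ.≮⇒≥ B≮d²

cut-bound : ∀ {n} k' (G : Graph n) (f : Partition n (suc k')) {B} → defect G f * defect G f ≤ + B →
  let a = k' ℕ.* edgeCount G ; b = suc k' ℕ.* cutCount G f in (a ℕ.∸ b) ℕ.* (a ℕ.∸ b) ℕ.≤ B
cut-bound k' G f d²≤B = ∸-square-≤ (k' ℕ.* edgeCount G) (suc k' ℕ.* cutCount G f)
  (subst (λ d → d * d ≤ _) defect≡difference d²≤B)
  where
  defect≡difference : defect G f ≡ + (k' ℕ.* edgeCount G) - + (suc k' ℕ.* cutCount G f)
  defect≡difference = trans (defect≡ G f) (sym (cong₂ _-_ (ℤ.pos-* k' _) (ℤ.pos-* (suc k') _)))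

theorem2 : (k ℓ n : ℕ) → 2 ℕ.≤ k → 1 ℕ.≤ ℓ → (G : Fin ℓ → Graph n) →
    Σ (Partition n k) (λ f → (i : Fin ℓ) →
    ((k ℕ.∸ 1) ℕ.* edgeCount (G i) ℕ.∸ k ℕ.* cutCount (G i) f)
    ℕ.* ((k ℕ.∸ 1) ℕ.* edgeCount (G i) ℕ.∸ k ℕ.* cutCount (G i) f)
    ℕ.≤ k ℕ.* k ℕ.* (2 ℕ.* ℓ ℕ.* edgeCount (G i)))
theorem2 k@(suc k') ℓ@(suc _) n (s≤s _) (s≤s _) G =
  let f , typical = union-bound bad few-bad
  in  f , λ i → cut-bound k' (G i) f (¬exceeds⇒≤ {G = G i} {f} (typical i))
  where
  bad : Fin ℓ → Partition n k → Bool
  bad i = exceeds (k ℕ.* k ℕ.* (2 ℕ.* ℓ ℕ.* edgeCount (G i))) (G i)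
  few-bad : ∑[ i < ℓ ] ∑ᴾ (λ f → 𝟙 (bad i f)) < + (k ^ n)
  few-bad = ∑-<-when-small {{_}} {{ℕ.m^n≢0 k n}} (λ i → ∑ᴾ (λ f → 𝟙 (bad i f)))
                           (λ i → rarely-exceeds k' ℓ (G i))
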